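{- Let $p$ be a sufficiently large prime and let $\mathcal{H}$ be the $3$-uniform hypergraph defined below. Then $\mathcal{H}$ is a linear hypergraph, i.e. any two distinct hyperedges of $\mathcal{H}$ share at most one vertex.
   Context: Let $p$ be a sufficiently large prime. In $\mathbb{F}_p$ define $T_1=\{2,3,\dots,\frac{p-1}{2}\}$, $T_2=\{\frac{p+3}{2},\dots,p-1\}$, $T_3=\mathbb{F}_p\setminus\{ -x^{2}:x\in\mathbb{F}_p\}$, $T_4=\{x: x^{2}-4x+1=0\}\cup\{x:3x-1=0\}\cup\{x:3x-2=0\}$, and $T_5=\{x: x^5-\frac{12757}{10872}x^4+\frac{1123}{3624}x^3+\frac{289}{1359}x^2-\frac{49}{453}x-\frac{2}{151}=0\}$. Choose $i\in\{1,2\}$ with $|T_i\cap T_3|\ge\frac{p-7}{4}$ and let $S_1=(T_i\cap T_3)\setminus(T_4\cup T_5)$, and $S_2=\mathbb{F}_p\setminus\{0,1\}$. For $1\le j\le 3$ let $V_j=S_1\times S_2\times S_2\times\{j\}$. For $x_1,x_2,x_3\in S_1$ and $a\in\mathbb{F}_p^{*}$ let $e(x_1,x_2,x_3,a)=\{(x_1,x_2x_3+a,x_2^{2}x_3+a,1),\ (x_2,x_3x_1+a,x_3^{2}x_1+a,2),\ (x_3,x_1x_2+a,x_1^{2}x_2+a,3)\}$. The hypergraph $\mathcal{H}$ has vertex set $V_1\cup V_2\cup V_3$ and edge set $\{e(x_1,x_2,x_3,a): x_1,x_2,x_3\in S_1,\ a\in\mathbb{F}_p^{*},\ e(x_1,x_2,x_3,a)\subseteq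 V_1\cup V_2\cup V_3\}$. -}

module Defs where

open import Data.Nat using (ℕ; zero; suc; _+_; _*_; _∸_; _≤_; _<_; NonZero)
open import Data.Nat.Properties using (_≟_; _≤?_; anyUpTo?)
open import Data.Nat.DivMod using (_/_; _%_)
open import Data.Product using (_×_; _,_; ∃)
open import Data.Sum using (_⊎_)
open import Data.List using (List; []; _∷_; length; filter; upTo)
open import Data.List.Membership.Propositional using (_∈_)
open import Relation.Nullary using (¬_; Dec; yes; no)
open import Relation.Nullary.Decidable using (_×-dec_; _⊎-dec_; ¬?)
open import Relation.Binary.PropositionalEquality using (_≡_; _≢_)

-- Elements of F_p are represented canonically by natural numbers x < p,
-- and the field operations are ℕ-operations followed by reduction mod p.

module _ (p : ℕ) .{{_ : NonZero p}} where

  infix 4 _≡ₚ_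
  _≡ₚ_ : ℕ → ℕ → Set
  a ≡ₚ b = a % p ≡ b % p

  T₁ : ℕ → Set
  T₁ x = 2 ≤ x × x ≤ (p ∸ 1) / 2

  T₂ : ℕ → Set
  T₂ x = (p + 3) / 2 ≤ x × x ≤ p ∸ 1

  -- T3 = F_p \ {-y^2 : y ∈ F_p}   (x = -y^2  iff  y^2 + x ≡ 0 mod p)
  T₃ : ℕ → Set
  T₃ x = x < p × ¬ (∃ λ y → y < p × (y * y + x) % p ≡ 0)

  T₄ : ℕ → Set
  T₄ x = (x * x + 1 ≡ₚ 4 * x) ⊎ (3 * x ≡ₚ 1) ⊎ (3 * x ≡ₚ 2)

  -- T5 = roots of x^5 - 12757/10872 x^4 + 1123/3624 x^3 + 289/1359 x^2
  --                - 49/453 x - 2/151,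
  -- written after multiplying by 10872 = lcm of the denominators
  -- (equivalent for p ∤ 10872, i.e. for all sufficiently large p):
  -- 10872 x^5 - 12757 x^4 + 3369 x^3 + 2312 x^2 - 1176 x - 144 = 0.
  T₅ : ℕ → Set
  T₅ x = (10872 * (x * x * x * x * x) + 3369 * (x * x * x) + 2312 * (x * x))
         ≡ₚ (12757 * (x * x * x * x) + 1176 * x + 144)

  data Choice : Set where
    one two : Choice

  Tᵢ : Choice → ℕ → Set
  Tᵢ one = T₁
  Tᵢ two = T₂

  Tᵢ∩T₃? : (i : Choice) → (x : ℕ) → Dec (Tᵢ i x × T₃ x)
  Tᵢ∩T₃? one x = ((2 ≤? x) ×-dec (x ≤? (p ∸ 1) / 2)) ×-dec
                 ((x <? p) ×-dec ¬? (anyUpTo? (λ y → (y * y + x) % p ≟ 0) p))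
    where open import Data.Nat.Properties using (_<?_)
  Tᵢ∩T₃? two x = (((p + 3) / 2 ≤? x) ×-dec (x ≤? p ∸ 1)) ×-dec
                 ((x <? p) ×-dec ¬? (anyUpTo? (λ y → (y * y + x) % p ≟ 0) p))
    where open import Data.Nat.Properties using (_<?_)

  cardTᵢ∩T₃ : Choice → ℕ
  cardTᵢ∩T₃ i = length (filter (Tᵢ∩T₃? i) (upTo p))

  -- the admissibility condition |T_i ∩ T_3| ≥ (p-7)/4, i.e. 4|T_i ∩ T_3| ≥ p - 7
  GoodChoice : Choice → Set
  GoodChoice i = p ≤ 4 * cardTᵢ∩T₃ i + 7

  S₁ : Choice → ℕ → Set
  S₁ i x = Tᵢ i x × T₃ x × ¬ T₄ x × ¬ T₅ x

  S₂ : ℕ → Set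
  S₂ x = x < p × x ≢ 0 × x ≢ 1

  Vertex : Set
  Vertex = ℕ × ℕ × ℕ × ℕ

  InV : Choice → Vertex → Set
  InV i (s , u , v , j) = S₁ i s × S₂ u × S₂ v × (j ≡ 1 ⊎ j ≡ 2 ⊎ j ≡ 3)

  edge : ℕ → ℕ → ℕ → ℕ → List Vertex
  edge x₁ x₂ x₃ a =
      (x₁ , (x₂ * x₃ + a) % p , (x₂ * x₂ * x₃ + a) % p , 1)
    ∷ (x₂ , (x₃ * x₁ + a) % p , (x₃ * x₃ * x₁ + a) % p , 2)
    ∷ (x₃ , (x₁ * x₂ + a) % p , (x₁ * x₁ * x₂ + a) % p , 3)
    ∷ []

  IsEdge : Choice → List Vertex → Set
  IsEdge i E = ∃ λ x₁ → ∃ λ x₂ → ∃ λ x₃ → ∃ λ a →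
      S₁ i x₁ × S₁ i x₂ × S₁ i x₃ × (1 ≤ a × a < p)
    × (∀ v → v ∈ edge x₁ x₂ x₃ a → InV i v)
    × E ≡ edge x₁ x₂ x₃ a

  Linear : Choice → Set
  Linear i = ∀ E F → IsEdge i E → IsEdge i F →
    ¬ (∀ v → (v ∈ E → v ∈ F) × (v ∈ F → v ∈ E)) →
    ∀ u w → u ∈ E → u ∈ F → w ∈ E → w ∈ F → u ≡ w

{-# OPTIONS --safe #-}
-- Two distinct edges can only meet in vertices of the same layer j, and the
-- first coordinate of a vertex of layer j is the parameter x_j. So if two
-- edges share vertices in two different layers, they agree on two of the
-- parameters, say x₁ and x₂, and the remaining two coordinates of their common
-- layer-1 vertex give x₂ x₃ + a = x₂ y₃ + b and x₂² x₃ + a = x₂² y₃ + b.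
-- Subtracting, x₂ (x₂ - 1) (x₃ - y₃) = 0, and x₂ ∉ {0, 1} forces x₃ = y₃ and
-- then a = b: the two edges coincide.
module Submission where

open import Defs
open import Data.Nat using (ℕ; _≤_; NonZero)
open import Data.Nat.Primality using (Prime)
open import Data.Product using (∃)

open import Data.Nat as ℕ using (zero; suc; _<_; ∣_-_∣; s≤s; z≤n)
open import Data.Nat.Properties
  using (∣m-n∣≤m⊔n; ∣m-n∣≡0⇒m≡n; ∣m+n-m+o∣≡∣n-o∣; m≤n⇒∣m-n∣≡n∸m; m≤n⇒∣n-m∣≡n∸m;
         *-distribʳ-∣-∣; ⊔-lub; ≤-total; ≤-trans; ≤-<-trans; +-monoˡ-≤; n≢0⇒n>0; suc-injective)
open import Data.Nat.DivMod using (_/_; _%_; m≡m%n+[m/n]*n; /-monoˡ-≤)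
open import Data.Nat.Divisibility using (n∣m*n; >⇒∤) renaming (_∣_ to _∣ℕ_)
open import Data.Nat.Primality using (euclidsLemma)
open import Data.Integer as ℤ using (ℤ; +_; 1ℤ; _⊖_)
open import Data.Integer.Properties using (pos-+; pos-*; abs-*; m-n≡m⊖n; ∣⊖∣-≤; ∣m⊖n∣≡∣n⊖m∣)
open import Data.Integer.Divisibility.Signed using (_∣_; ∣⇒∣ᵤ; ∣ᵤ⇒∣; ∣m∣n⇒∣m-n; ∣n⇒∣m*n)
open import Data.Integer.Tactic.RingSolver using (solve-∀)
open import Data.Fin using (Fin; toℕ) renaming (zero to 0F; suc to sucF)
open import Data.Fin.Properties using (toℕ-injective; _≟_)
open import Data.Product as Product using (_×_; _,_)
open import Data.Sum using (inj₁; inj₂)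
open import Data.List using (lookup)
open import Data.List.Membership.Propositional using (_∈_)
open import Data.List.Relation.Unary.Any using (index)
open import Data.List.Relation.Unary.Any.Properties using (lookup-index)
open import Data.List.Relation.Binary.Subset.Propositional.Properties using (⊆-reflexive)
open import Function using (_∘_)
open import Relation.Nullary using (¬_; yes; no; contradiction)
open import Relation.Binary.PropositionalEquality

∣+m-+n∣≡∣m-n∣ : ∀ m n → ℤ.∣ + m ℤ.- + n ∣ ≡ ∣ m - n ∣
∣+m-+n∣≡∣m-n∣ m n with ≤-total m n
... | inj₁ m≤n = begin
  ℤ.∣ + m ℤ.- + n ∣ ≡⟨ cong ℤ.∣_∣ (m-n≡m⊖n m n) ⟩
  ℤ.∣ m ⊖ n ∣       ≡⟨ ∣⊖∣-≤ m≤n ⟩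
  n ℕ.∸ m           ≡⟨ sym (m≤n⇒∣m-n∣≡n∸m m≤n) ⟩
  ∣ m - n ∣         ∎
  where open ≡-Reasoning
... | inj₂ n≤m = begin
  ℤ.∣ + m ℤ.- + n ∣ ≡⟨ cong ℤ.∣_∣ (m-n≡m⊖n m n) ⟩
  ℤ.∣ m ⊖ n ∣       ≡⟨ ∣m⊖n∣≡∣n⊖m∣ m n ⟩
  ℤ.∣ n ⊖ m ∣       ≡⟨ ∣⊖∣-≤ n≤m ⟩
  m ℕ.∸ n           ≡⟨ sym (m≤n⇒∣n-m∣≡n∸m n≤m) ⟩
  ∣ m - n ∣         ∎
  where open ≡-Reasoning

∣∧<⇒≡0 : ∀ {p n} → p ∣ℕ n → n < p → n ≡ 0
∣∧<⇒≡0 {n = zero}  _    _   = refl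
∣∧<⇒≡0 {n = suc _} p∣n n<p = contradiction p∣n (>⇒∤ n<p)

module _ {p : ℕ} (p-prime : Prime p) where

  open import Data.Integer using (_+_; _-_; _*_)

  ∣i*j∧∤i⇒∣j : ∀ {i j} → + p ∣ i * j → ¬ + p ∣ i → + p ∣ j
  ∣i*j∧∤i⇒∣j {i} {j} p∣ij p∤i
    with euclidsLemma ℤ.∣ i ∣ ℤ.∣ j ∣ p-prime (subst (p ∣ℕ_) (abs-* i j) (∣⇒∣ᵤ p∣ij))
  ... | inj₁ p∣i = contradiction (∣ᵤ⇒∣ p∣i) p∤i
  ... | inj₂ p∣j = ∣ᵤ⇒∣ p∣j

  -- The second difference of the two congruences is s (s - 1) (x - y).
  affine-pair-cancel : ∀ {s x y a b} → ¬ + p ∣ s → ¬ + p ∣ s - 1ℤ →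
    + p ∣ (s * x + a) - (s * y + b) →
    + p ∣ (s * s * x + a) - (s * s * y + b) →
    (+ p ∣ x - y) × (+ p ∣ a - b)
  affine-pair-cancel {s} {x} {y} {a} {b} p∤s p∤s-1 p∣lin p∣quad = p∣x-y , p∣a-b
    where
    second-difference : ∀ s x y a b →
      (s * s * x + a - (s * s * y + b)) - (s * x + a - (s * y + b)) ≡ s * ((s - 1ℤ) * (x - y))
    second-difference = solve-∀

    first-difference : ∀ s x y a b → (s * x + a - (s * y + b)) - s * (x - y) ≡ a - b
    first-difference = solve-∀

    p∣x-y : + p ∣ x - y
    p∣x-y = ∣i*j∧∤i⇒∣j (∣i*j∧∤i⇒∣j p∣s[s-1][x-y] p∤s) p∤s-1
      where
      p∣s[s-1][x-y] = subst (+ p ∣_) (second-difference s x y a b) (∣m∣n⇒∣m-n p∣quad p∣lin)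

    p∣a-b : + p ∣ a - b
    p∣a-b = subst (+ p ∣_) (first-difference s x y a b) (∣m∣n⇒∣m-n p∣lin (∣n⇒∣m*n s p∣x-y))

open import Data.Nat using (_+_; _*_)

pos-affine : ∀ m x a → + (m * x + a) ≡ + m ℤ.* + x ℤ.+ + a
pos-affine m x a = trans (pos-+ (m * x) a) (cong (ℤ._+ + a) (pos-* m x))

pos-quadratic : ∀ m x a → + (m * m * x + a) ≡ + m ℤ.* + m ℤ.* + x ℤ.+ + a
pos-quadratic m x a = trans (pos-affine (m * m) x a) (cong (λ t → t ℤ.* + x ℤ.+ + a) (pos-* m m))

module _ (p : ℕ) .{{_ : NonZero p}} where

  %≡%⇒∣- : ∀ {m n} → m % p ≡ n % p → + p ∣ + m ℤ.- + n
  %≡%⇒∣- {m} {n} m≡n = ∣ᵤ⇒∣ (subst (p ∣ℕ_) (sym (∣+m-+n∣≡∣m-n∣ m n)) p∣∣m-n∣)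
    where
    open ≡-Reasoning
    ∣m-n∣≡∣m/p-n/p∣*p : ∣ m - n ∣ ≡ ∣ m / p - n / p ∣ * p
    ∣m-n∣≡∣m/p-n/p∣*p = begin
      ∣ m - n ∣                                 ≡⟨ cong₂ ∣_-_∣ (m≡m%n+[m/n]*n m p) (m≡m%n+[m/n]*n n p) ⟩
      ∣ m % p + m / p * p - n % p + n / p * p ∣ ≡⟨ cong (λ r → ∣ m % p + m / p * p - r + n / p * p ∣) (sym m≡n) ⟩
      ∣ m % p + m / p * p - m % p + n / p * p ∣ ≡⟨ ∣m+n-m+o∣≡∣n-o∣ (m % p) _ _ ⟩
      ∣ m / p * p - n / p * p ∣                 ≡⟨ *-distribʳ-∣-∣ p (m / p) (n / p) ⟨
      ∣ m / p - n / p ∣ * p                     ∎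
    p∣∣m-n∣ : p ∣ℕ ∣ m - n ∣
    p∣∣m-n∣ = subst (p ∣ℕ_) (sym ∣m-n∣≡∣m/p-n/p∣*p) (n∣m*n ∣ m / p - n / p ∣)

  ∣-⇒≡ : ∀ {m n} → m < p → n < p → + p ∣ + m ℤ.- + n → m ≡ n
  ∣-⇒≡ {m} {n} m<p n<p p∣m-n =
    ∣m-n∣≡0⇒m≡n (∣∧<⇒≡0 p∣∣m-n∣ (≤-<-trans (∣m-n∣≤m⊔n m n) (⊔-lub m<p n<p)))
    where
    p∣∣m-n∣ : p ∣ℕ ∣ m - n ∣
    p∣∣m-n∣ = subst (p ∣ℕ_) (∣+m-+n∣≡∣m-n∣ m n) (∣⇒∣ᵤ p∣m-n)

  S₂⇒∤ : ∀ {s} → S₂ p s → ¬ + p ∣ + s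
  S₂⇒∤ (s<p , s≢0 , _) p∣s = s≢0 (∣∧<⇒≡0 (∣⇒∣ᵤ p∣s) s<p)

  S₂⇒∤-1 : ∀ {s} → S₂ p s → ¬ + p ∣ + s ℤ.- 1ℤ
  S₂⇒∤-1 (s<p , s≢0 , s≢1) p∣s-1 = s≢1 (∣-⇒≡ s<p (≤-<-trans (n≢0⇒n>0 s≢0) s<p) p∣s-1)

  affine-cancel : Prime p → ∀ {s x y a b} → S₂ p s → x < p → y < p → a < p → b < p →
    (s * x + a) % p ≡ (s * y + b) % p →
    (s * s * x + a) % p ≡ (s * s * y + b) % p →
    x ≡ y × a ≡ b
  affine-cancel p-prime {s} {x} {y} {a} {b} s∈S₂ x<p y<p a<p b<p lin quad =
    Product.map (∣-⇒≡ x<p y<p) (∣-⇒≡ a<p b<p)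
      (affine-pair-cancel p-prime (S₂⇒∤ s∈S₂) (S₂⇒∤-1 s∈S₂)
        (subst (+ p ∣_) (cong₂ ℤ._-_ (pos-affine s x a) (pos-affine s y b)) (%≡%⇒∣- lin))
        (subst (+ p ∣_) (cong₂ ℤ._-_ (pos-quadratic s x a) (pos-quadratic s y b)) (%≡%⇒∣- quad)))

  base value₁ value₂ layer : Vertex p → ℕ
  base    (s , _ , _ , _) = s
  value₁  (_ , u , _ , _) = u
  value₂  (_ , _ , v , _) = v
  layer   (_ , _ , _ , j) = j

  layer-lookup : ∀ x₁ x₂ x₃ a (k : Fin 3) → layer (lookup (edge p x₁ x₂ x₃ a) k) ≡ suc (toℕ k)
  layer-lookup _ _ _ _ 0F               = refl
  layer-lookup _ _ _ _ (sucF 0F)        = refl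
  layer-lookup _ _ _ _ (sucF (sucF 0F)) = refl

  common-corner : ∀ {u x₁ x₂ x₃ a y₁ y₂ y₃ b} →
    u ∈ edge p x₁ x₂ x₃ a → u ∈ edge p y₁ y₂ y₃ b →
    ∃ λ k → u ≡ lookup (edge p x₁ x₂ x₃ a) k × u ≡ lookup (edge p y₁ y₂ y₃ b) k
  common-corner {u} {x₁} {x₂} {x₃} {a} {y₁} {y₂} {y₃} {b} u∈E u∈F =
    index u∈E , lookup-index u∈E ,
    subst (λ k → u ≡ lookup (edge p y₁ y₂ y₃ b) k) (sym same-index) (lookup-index u∈F)
    where
    open ≡-Reasoning
    same-index : index u∈E ≡ index u∈F
    same-index = toℕ-injective (suc-injective (begin
      suc (toℕ (index u∈E))                           ≡⟨ layer-lookup x₁ x₂ x₃ a (index u∈E) ⟨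
      layer (lookup (edge p x₁ x₂ x₃ a) (index u∈E))  ≡⟨ cong layer (lookup-index u∈E) ⟨
      layer u                                         ≡⟨ cong layer (lookup-index u∈F) ⟩
      layer (lookup (edge p y₁ y₂ y₃ b) (index u∈F))  ≡⟨ layer-lookup y₁ y₂ y₃ b (index u∈F) ⟩
      suc (toℕ (index u∈F))                           ∎))

  Admissible : ℕ → ℕ → ℕ → ℕ → Set
  Admissible x₁ x₂ x₃ a = S₂ p x₁ × S₂ p x₂ × S₂ p x₃ × a < p

  -- Corners k and k + 1 (mod 3) pin down the parameters x_k and x_{k+1}; the
  -- other two coordinates of corner k then determine x_{k+2} and a.
  two-corners⇒same-edge : Prime p → ∀ {x₁ x₂ x₃ a y₁ y₂ y₃ b} {k l : Fin 3} →
    Admissible x₁ x₂ x₃ a → Admissible y₁ y₂ y₃ b → k ≢ l →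
    lookup (edge p x₁ x₂ x₃ a) k ≡ lookup (edge p y₁ y₂ y₃ b) k →
    lookup (edge p x₁ x₂ x₃ a) l ≡ lookup (edge p y₁ y₂ y₃ b) l →
    edge p x₁ x₂ x₃ a ≡ edge p y₁ y₂ y₃ b
  two-corners⇒same-edge _ {k = 0F} {0F} _ _ k≢l _ _ = contradiction refl k≢l
  two-corners⇒same-edge _ {k = sucF 0F} {sucF 0F} _ _ k≢l _ _ = contradiction refl k≢l
  two-corners⇒same-edge _ {k = sucF (sucF 0F)} {sucF (sucF 0F)} _ _ k≢l _ _ =
    contradiction refl k≢l
  two-corners⇒same-edge p-prime {k = 0F} {sucF 0F}
      (_ , x₂∈S₂ , (x₃<p , _) , a<p) (_ , _ , (y₃<p , _) , b<p) _ e f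
    with cong base e | cong base f
  ... | refl | refl = Product.uncurry (cong₂ (λ x₃ a → edge p _ _ x₃ a))
    (affine-cancel p-prime x₂∈S₂ x₃<p y₃<p a<p b<p (cong value₁ e) (cong value₂ e))
  two-corners⇒same-edge p-prime {k = sucF 0F} {sucF (sucF 0F)}
      ((x₁<p , _) , _ , x₃∈S₂ , a<p) ((y₁<p , _) , _ , _ , b<p) _ e f
    with cong base e | cong base f
  ... | refl | refl = Product.uncurry (cong₂ (λ x₁ a → edge p x₁ _ _ a))
    (affine-cancel p-prime x₃∈S₂ x₁<p y₁<p a<p b<p (cong value₁ e) (cong value₂ e))
  two-corners⇒same-edge p-prime {k = sucF (sucF 0F)} {0F}
      (x₁∈S₂ , (x₂<p , _) , _ , a<p) (_ , (y₂<p , _) , _ , b<p) _ e f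
    with cong base e | cong base f
  ... | refl | refl = Product.uncurry (cong₂ (λ x₂ a → edge p _ x₂ _ a))
    (affine-cancel p-prime x₁∈S₂ x₂<p y₂<p a<p b<p (cong value₁ e) (cong value₂ e))
  two-corners⇒same-edge p-prime {k = sucF 0F} {0F} adm₁ adm₂ k≢l e f =
    two-corners⇒same-edge p-prime adm₁ adm₂ (k≢l ∘ sym) f e
  two-corners⇒same-edge p-prime {k = sucF (sucF 0F)} {sucF 0F} adm₁ adm₂ k≢l e f =
    two-corners⇒same-edge p-prime adm₁ adm₂ (k≢l ∘ sym) f e
  two-corners⇒same-edge p-prime {k = 0F} {sucF (sucF 0F)} adm₁ adm₂ k≢l e f =
    two-corners⇒same-edge p-prime adm₁ adm₂ (k≢l ∘ sym) f e

  two-common-corners⇒≡ : Prime p → ∀ {x₁ x₂ x₃ a y₁ y₂ y₃ b u w} →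
    Admissible x₁ x₂ x₃ a → Admissible y₁ y₂ y₃ b → edge p x₁ x₂ x₃ a ≢ edge p y₁ y₂ y₃ b →
    (∃ λ k → u ≡ lookup (edge p x₁ x₂ x₃ a) k × u ≡ lookup (edge p y₁ y₂ y₃ b) k) →
    (∃ λ l → w ≡ lookup (edge p x₁ x₂ x₃ a) l × w ≡ lookup (edge p y₁ y₂ y₃ b) l) →
    u ≡ w
  two-common-corners⇒≡ p-prime adm₁ adm₂ E≢F
      (k , u≡E[k] , u≡F[k]) (l , w≡E[l] , w≡F[l])
    with k ≟ l
  ... | yes refl = trans u≡E[k] (sym w≡E[l])
  ... | no k≢l = contradiction
    (two-corners⇒same-edge p-prime adm₁ adm₂ k≢l
      (trans (sym u≡E[k]) u≡F[k]) (trans (sym w≡E[l]) w≡F[l]))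
    E≢F

  2≤∧<⇒S₂ : ∀ {x} → 2 ≤ x → x < p → S₂ p x
  2≤∧<⇒S₂ (s≤s (s≤s _)) x<p = x<p , (λ ()) , (λ ())

  S₁⇒S₂ : ∀ i {x} → S₁ p i x → S₂ p x
  S₁⇒S₂ one ((2≤x , _) , (x<p , _) , _) = 2≤∧<⇒S₂ 2≤x x<p
  S₁⇒S₂ two ((⌈p/2⌉+1≤x , _) , (x<p , _) , _) =
    2≤∧<⇒S₂ (≤-trans (/-monoˡ-≤ 2 (+-monoˡ-≤ 3 (≤-trans (s≤s z≤n) x<p))) ⌈p/2⌉+1≤x) x<p

  linear : Prime p → ∀ i → Linear p i
  linear p-prime i _ _ (_ , _ , _ , _ , x₁∈S₁ , x₂∈S₁ , x₃∈S₁ , (_ , a<p) , _ , refl)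
                       (_ , _ , _ , _ , y₁∈S₁ , y₂∈S₁ , y₃∈S₁ , (_ , b<p) , _ , refl)
                       E≉F u w u∈E u∈F w∈E w∈F =
    two-common-corners⇒≡ p-prime
      (S₁⇒S₂ i x₁∈S₁ , S₁⇒S₂ i x₂∈S₁ , S₁⇒S₂ i x₃∈S₁ , a<p)
      (S₁⇒S₂ i y₁∈S₁ , S₁⇒S₂ i y₂∈S₁ , S₁⇒S₂ i y₃∈S₁ , b<p)
      (λ E≡F → E≉F λ _ → ⊆-reflexive E≡F , ⊆-reflexive (sym E≡F))
      (common-corner u∈E u∈F) (common-corner w∈E w∈F)

-- Linearity holds for every prime and either choice of i, so no lower bound on p is needed.
proposition4p1 : ∃ λ P → ∀ (p : ℕ) .{{_ : NonZero p}} → Prime p → P ≤ p →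
    ∀ (i : Choice p) → GoodChoice p i → Linear p i
proposition4p1 = 0 , λ p p-prime _ i _ → linear p p-prime i
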